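{- Let $P$ and $Q$ be two colored paths on $m$ vertices with $\det(K_P)=\det(K_Q)$. Then: (1) the multiset of vertex colors of $P$ equals that of $Q$, and the multiset of edge colors of $P$ equals that of $Q$; (2) for every edge $\{a,b\}$ of $P$ there is an edge $\{x,y\}$ of $Q$ with $\lambda(\{x,y\})=\lambda(\{a,b\})$ and $\{\lambda(x),\lambda(y)\}=\{\lambda(a),\lambda(b)\}$ as multisets, and vice versa with the roles of $P$ and $Q$ exchanged.
   Context: A colored path $P$ on $m$ vertices has vertices $p_1,\dots,p_m$ in order and edges $\{p_i,p_{i+1}\}$, with a coloring $\lambda$ of vertices and edges drawn from a common palette, vertex colors disjoint from edge colors. Each color $c$ has an indeterminate $t_c$, and $K_P$ is the symmetric tridiagonal $m\times m$ matrix with diagonal entries $t_{\lambda(p_i)}$ and off-diagonal entries $(K_P)_{i,i+1}=(K_P)_{i+1,i}=t_{\lambda(\{p_i,p_{i+1}\})}$; determinants are compared as polynomials in the $t_c$. -}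

module Defs where

open import Level using (0ℓ)
open import Data.Nat using (ℕ; zero; suc)
open import Data.Fin using (Fin; zero; suc; inject₁; punchIn; toℕ)
open import Data.Maybe using (Maybe; just; nothing; maybe)
open import Data.Sum using (_⊎_; inj₁; inj₂)
open import Data.List using (List; tabulate; _∷_; [])
open import Data.List.Relation.Binary.Permutation.Propositional using (_↭_)
open import Data.Product using (Σ; _×_)
open import Function using (_∘_)
open import Relation.Binary.PropositionalEquality using (_≡_)
open import Algebra.Bundles using (CommutativeRing)

-- A colored path on m = suc n vertices p_0 … p_n, edges {p_k , p_(k+1)} for k : Fin n.
-- Vertex colors come from V, edge colors from E; the common palette is V ⊎ E
-- (so vertex colors and edge colors are disjoint by construction).
record ColoredPath (V E : Set) (n : ℕ) : Set where
  field
    vcol : Fin (suc n) → V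
    ecol : Fin n → E
open ColoredPath public

-- Endpoints of edge k : the vertices inject₁ k and suc k.
-- Color pattern of the tridiagonal matrix: entry (i,j) is the color of p_i if i = j,
-- the color of the edge {p_i,p_j} if |i-j| = 1, and nothing (entry 0) otherwise.
triColor : {V E : Set} (n : ℕ) → (Fin (suc n) → V) → (Fin n → E) →
           Fin (suc n) → Fin (suc n) → Maybe (V ⊎ E)
triColor n       d e zero          zero          = just (inj₁ (d zero))
triColor (suc n) d e zero          (suc zero)    = just (inj₂ (e zero))
triColor (suc n) d e (suc zero)    zero          = just (inj₂ (e zero))
triColor (suc n) d e zero          (suc (suc j)) = nothing
triColor (suc n) d e (suc (suc i)) zero          = nothing
triColor (suc n) d e (suc i)       (suc j)       = triColor n (d ∘ suc) (e ∘ suc) i j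

module _ (R : CommutativeRing 0ℓ 0ℓ) where
  open CommutativeRing R using (Carrier; _+_; _*_; -_; 0#; 1#)

  sumFin : (n : ℕ) → (Fin n → Carrier) → Carrier
  sumFin zero    f = 0#
  sumFin (suc n) f = f zero + sumFin n (f ∘ suc)

  signR : ℕ → Carrier
  signR zero    = 1#
  signR (suc k) = - signR k

  det : (n : ℕ) → (Fin n → Fin n → Carrier) → Carrier
  det zero    A = 1#
  det (suc n) A = sumFin (suc n) λ j →
    signR (toℕ j) * (A zero j * det n (λ i k → A (suc i) (punchIn j k)))

  -- The matrix K_P, with the indeterminates t_c evaluated at t c ∈ R.
  K : {V E : Set} {n : ℕ} → ColoredPath V E n → (V ⊎ E → Carrier) →
      Fin (suc n) → Fin (suc n) → Carrier
  K {n = n} P t i j = maybe t 0# (triColor n (vcol P) (ecol P) i j)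

-- det(K_P) = det(K_Q) as polynomials in the indeterminates t_c (c ∈ V ⊎ E) over ℤ:
-- equality in the free commutative ring ℤ[t_c], i.e. equality after substituting
-- the indeterminates by arbitrary elements of an arbitrary commutative ring
-- (universal property of the polynomial ring; take R = ℤ[t_c], t = the indeterminates).
DetPolyEq : {V E : Set} {n : ℕ} → ColoredPath V E n → ColoredPath V E n → Set₁
DetPolyEq {V} {E} {n} P Q =
  (R : CommutativeRing 0ℓ 0ℓ) (t : V ⊎ E → CommutativeRing.Carrier R) →
  CommutativeRing._≈_ R (det R (suc n) (K R P t)) (det R (suc n) (K R Q t))

endColors : {V E : Set} {n : ℕ} → ColoredPath V E n → Fin n → List V
endColors P k = vcol P (inject₁ k) ∷ vcol P (suc k) ∷ []

EdgesMatched : {V E : Set} {n : ℕ} → ColoredPath V E n → ColoredPath V E n → Set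
EdgesMatched P Q = ∀ k → Σ _ λ l → (ecol Q l ≡ ecol P k) × (endColors Q l ↭ endColors P k)

-- Since DetPolyEq holds in every commutative ring, compute in ℤ[t][ε]/(ε³) with t_v ↦ t_v for vertex
-- colors and t_e ↦ ε t_e for edge colors. Expanding along the first row gives
-- det K_P = t_{λ(p₁)} det K_{P∖p₁} − t_{λ(p₁p₂)}² det K_{P∖p₁p₂}, and by induction
-- det K_P ≡ ∏ᵢ t_{λ(pᵢ)} − ε² Σₖ t_{λ(pₖpₖ₊₁)}² ∏_{i ∉ {k,k+1}} t_{λ(pᵢ)}.
-- The ε⁰ coefficients of det K_P = det K_Q give the vertex color multisets; the ε² coefficients give
-- equal multisets of the monomials t_{λ(e)}² ∏_{v ∉ e} t_{λ(v)}, from which one reads off the edge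
-- colors, and, cancelling ∏_{v ∉ e} from ∏_v, the endpoint colors of corresponding edges.
module Submission where

open import Defs
open import Level using (Level; 0ℓ)
open import Algebra.Bundles using (CommutativeSemiring; CommutativeRing; CommutativeMonoid)
open import Algebra.Definitions using (LeftCancellative)
open import Algebra.Properties.CommutativeSemigroup using (interchange)
open import Algebra.Structures.Biased using (isCommutativeSemiringˡ; isCommutativeMonoidˡ)
open import Data.Nat using (ℕ; zero; suc)
open import Data.Fin using (Fin; zero; suc; punchIn; toℕ)
open import Data.List using (List; []; _∷_; _++_; map; mapMaybe; head; tabulate; cartesianProductWith)
import Data.List.Properties as List
open import Data.List.Membership.Propositional using (_∈_)
open import Data.List.Relation.Unary.All using (All; []; _∷_)
import Data.List.Relation.Unary.All.Properties as All
open import Data.List.Relation.Unary.Any using (here; there)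
import Data.List.Relation.Unary.Any.Properties as Any
import Data.List.Relation.Binary.Pointwise as Pointwise
open import Data.List.Relation.Binary.Permutation.Propositional as ↭
  using (_↭_; ↭-refl; ↭-sym; ↭-trans; ↭-reflexive; ↭-setoid; module PermutationReasoning)
open import Data.List.Relation.Binary.Permutation.Propositional.Properties as ↭
  using (∈-resp-↭; ↭-empty-inv; mapMaybe-↭; drop-∷; ++⁺ʳ; shift)
import Data.List.Relation.Binary.Permutation.Setoid as PermutationSetoid
import Data.List.Relation.Binary.Permutation.Setoid.Properties as PermutationSetoidProperties
open import Data.Maybe using (Maybe; just; maybe)
open import Data.Product using (_×_; _,_; proj₁; proj₂; ∃)
open import Data.Sum using (_⊎_; inj₁; inj₂; isInj₁; isInj₂)
open import Function using (_∘_)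
open import Relation.Binary.Bundles using (Setoid)
open import Relation.Binary.Definitions using (_Respects_)
open import Relation.Binary.PropositionalEquality as ≡ using (_≡_; cong; cong₂; subst₂)
open import Relation.Unary using (Pred)

module _ {a ℓ} (S : Setoid a ℓ) where
  open Setoid S using (_≈_) renaming (Carrier to A; refl to ≈-refl; trans to ≈-trans)
  open PermutationSetoid S using (refl; prep; swap; trans) renaming (_↭_ to _↭ₛ_)
  open PermutationSetoidProperties S using (All-resp-↭; Any-resp-↭)

  ↭ₛ-singleton⁻ : ∀ {x y} → x ∷ [] ↭ₛ y ∷ [] → x ≈ y
  ↭ₛ-singleton⁻ p with Any-resp-↭ (λ y≈z x≈y → ≈-trans x≈y y≈z) p (here ≈-refl)
  ... | here x≈y = x≈y

  map⁺-All : ∀ {b p} {B : Set b} {P : Pred A p} {f : A → B} →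
             P Respects _≈_ → (∀ {x y} → P x → x ≈ y → f x ≡ f y) →
             ∀ {xs ys} → All P xs → xs ↭ₛ ys → map f xs ↭ map f ys
  map⁺-All {P = P} {f} P-resp f-cong = go
    where
    pointwise : ∀ {xs ys} → All P xs → Pointwise.Pointwise _≈_ xs ys → map f xs ≡ map f ys
    pointwise []         Pointwise.[]           = ≡.refl
    pointwise (px ∷ pxs) (x≈y Pointwise.∷ xs≈ys) = cong₂ _∷_ (f-cong px x≈y) (pointwise pxs xs≈ys)

    go : ∀ {xs ys} → All P xs → xs ↭ₛ ys → map f xs ↭ map f ys
    go pxs        (refl xs≈ys)           = ↭-reflexive (pointwise pxs xs≈ys)
    go (px ∷ pxs) (prep {ys = ys} x≈y p) =
      ↭-trans (↭.prep _ (go pxs p)) (↭-reflexive (cong (_∷ map f ys) (f-cong px x≈y)))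
    go (px ∷ py ∷ pxs) (swap {ys = ys} x≈x′ y≈y′ p) = ↭-trans (↭.swap _ _ (go pxs p))
      (↭-reflexive (cong₂ (λ u v → u ∷ v ∷ map f ys) (f-cong py y≈y′) (f-cong px x≈x′)))
    go pxs        (trans p q)            = ↭-trans (go pxs p) (go (All-resp-↭ P-resp p pxs) q)

module _ {a} {A : Set a} where

  ++-cancelˡ-↭ : ∀ xs {ys zs : List A} → xs ++ ys ↭ xs ++ zs → ys ↭ zs
  ++-cancelˡ-↭ []       p = p
  ++-cancelˡ-↭ (x ∷ xs) p = ++-cancelˡ-↭ xs (drop-∷ p)

  ∈-doubleton : ∀ {x y : A} → x ∈ y ∷ y ∷ [] → x ≡ y
  ∈-doubleton (here x≡y)         = x≡y
  ∈-doubleton (there (here x≡y)) = x≡y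

  head-↭-doubleton : ∀ {xs} {y : A} → xs ↭ y ∷ y ∷ [] → head xs ≡ just y
  head-↭-doubleton {[]}    p with () ← ↭-empty-inv (↭-sym p)
  head-↭-doubleton {x ∷ _} p = cong just (∈-doubleton (∈-resp-↭ p (here ≡.refl)))

  map⁻-retract : ∀ {b} {B : Set b} {f : B → Maybe A} {g : A → B} → (∀ x → f (g x) ≡ just x) →
                 ∀ {xs ys} → map g xs ↭ map g ys → xs ↭ ys
  map⁻-retract {f = f} retract {xs} {ys} p =
    subst₂ _↭_ (List.mapMaybe-map-retract retract xs) (List.mapMaybe-map-retract retract ys) (mapMaybe-↭ f p)

-- ℕ[A]: a monomial is a list of variables up to permutation, a polynomial a list of monomials up to
-- permutation (so repetitions are the natural coefficients).
module FreeCommutativeSemiring {a : Level} (A : Set a) where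

  Monomial : Set a
  Monomial = List A

  Polynomial : Set a
  Polynomial = List Monomial

  open PermutationSetoid (↭-setoid {A = A}) public
    using ()
    renaming (_↭_ to _≃_; ↭-refl to ≃-refl; ↭-sym to ≃-sym; ↭-trans to ≃-trans;
              ↭-reflexive to ≃-reflexive; ↭-reflexive-≋ to ≃-reflexive-≋; ↭-setoid to ≃-setoid)
  open PermutationSetoidProperties (↭-setoid {A = A})
    using (++⁺; map⁺; ++-comm; ++-isCommutativeMonoid; ++-commutativeMonoid; dropMiddle)
  open ≡.≡-Reasoning

  infixl 7 _⊗_
  _⊗_ : Polynomial → Polynomial → Polynomial
  _⊗_ = cartesianProductWith _++_

  map-≃ : ∀ {f g : Monomial → Monomial} → (∀ m → f m ↭ g m) → ∀ ps → map f ps ≃ map g ps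
  map-≃ f↭g ps = ≃-reflexive-≋ (Pointwise.map⁺ _ _ (Pointwise.refl λ {m} → f↭g m))

  ⊗-zeroʳ : ∀ ps → ps ⊗ [] ≡ []
  ⊗-zeroʳ []       = ≡.refl
  ⊗-zeroʳ (p ∷ ps) = ⊗-zeroʳ ps

  ⊗-identityˡ : ∀ ps → ([] ∷ []) ⊗ ps ≡ ps
  ⊗-identityˡ ps = ≡.trans (List.++-identityʳ _) (List.map-id ps)

  ⊗-distribʳ : ∀ rs ps qs → (ps ++ qs) ⊗ rs ≡ ps ⊗ rs ++ qs ⊗ rs
  ⊗-distribʳ rs []       qs = ≡.refl
  ⊗-distribʳ rs (p ∷ ps) qs = ≡.trans (cong (map (p ++_) rs ++_) (⊗-distribʳ rs ps qs))
                                       (≡.sym (List.++-assoc (map (p ++_) rs) (ps ⊗ rs) (qs ⊗ rs)))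

  map-++-⊗ : ∀ m ps qs → map (m ++_) ps ⊗ qs ≡ map (m ++_) (ps ⊗ qs)
  map-++-⊗ m []       qs = ≡.refl
  map-++-⊗ m (p ∷ ps) qs = begin
    map ((m ++ p) ++_) qs ++ map (m ++_) ps ⊗ qs
      ≡⟨ cong₂ _++_ (≡.trans (List.map-cong (List.++-assoc m p) qs) (List.map-∘ qs)) (map-++-⊗ m ps qs) ⟩
    map (m ++_) (map (p ++_) qs) ++ map (m ++_) (ps ⊗ qs)
      ≡⟨ List.map-++ (m ++_) (map (p ++_) qs) (ps ⊗ qs) ⟨
    map (m ++_) (map (p ++_) qs ++ ps ⊗ qs) ∎

  ⊗-assoc : ∀ ps qs rs → (ps ⊗ qs) ⊗ rs ≡ ps ⊗ (qs ⊗ rs)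
  ⊗-assoc []       qs rs = ≡.refl
  ⊗-assoc (p ∷ ps) qs rs = begin
    (map (p ++_) qs ++ ps ⊗ qs) ⊗ rs       ≡⟨ ⊗-distribʳ rs (map (p ++_) qs) (ps ⊗ qs) ⟩
    map (p ++_) qs ⊗ rs ++ (ps ⊗ qs) ⊗ rs  ≡⟨ cong₂ _++_ (map-++-⊗ p qs rs) (⊗-assoc ps qs rs) ⟩
    map (p ++_) (qs ⊗ rs) ++ ps ⊗ (qs ⊗ rs) ∎

  ⊗-congʳ : ∀ ps {qs rs} → qs ≃ rs → ps ⊗ qs ≃ ps ⊗ rs
  ⊗-congʳ []       qs≃rs = ≃-refl
  ⊗-congʳ (p ∷ ps) qs≃rs = ++⁺ (map⁺ ↭-setoid (↭.++⁺ˡ p) qs≃rs) (⊗-congʳ ps qs≃rs)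

  ⊗-distribˡ : ∀ ps qs rs → ps ⊗ (qs ++ rs) ≃ ps ⊗ qs ++ ps ⊗ rs
  ⊗-distribˡ []       qs rs = ≃-refl
  ⊗-distribˡ (p ∷ ps) qs rs = ≃-trans
    (++⁺ (≃-reflexive (List.map-++ (p ++_) qs rs)) (⊗-distribˡ ps qs rs))
    (interchange (CommutativeMonoid.commutativeSemigroup ++-commutativeMonoid)
                 (map (p ++_) qs) (map (p ++_) rs) (ps ⊗ qs) (ps ⊗ rs))

  ⊗-singletonʳ : ∀ m ps → ps ⊗ (m ∷ []) ≡ map (_++ m) ps
  ⊗-singletonʳ m []       = ≡.refl
  ⊗-singletonʳ m (p ∷ ps) = cong ((p ++ m) ∷_) (⊗-singletonʳ m ps)

  ⊗-comm : ∀ ps qs → ps ⊗ qs ≃ qs ⊗ ps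
  ⊗-comm []       qs = ≃-reflexive (≡.sym (⊗-zeroʳ qs))
  ⊗-comm (p ∷ ps) qs = ≃-trans
    (++⁺ (≃-trans (map-≃ (λ m → ↭.++-comm p m) qs) (≃-reflexive (≡.sym (⊗-singletonʳ p qs))))
         (⊗-comm ps qs))
    (≃-sym (⊗-distribˡ qs (p ∷ []) ps))

  ⊗-congˡ : ∀ ps {qs rs} → qs ≃ rs → qs ⊗ ps ≃ rs ⊗ ps
  ⊗-congˡ ps {qs} {rs} qs≃rs = ≃-trans (⊗-comm qs ps) (≃-trans (⊗-congʳ ps qs≃rs) (⊗-comm ps rs))

  commutativeSemiring : CommutativeSemiring a a
  commutativeSemiring = record
    { Carrier = Polynomial
    ; _≈_ = _≃_
    ; _+_ = _++_
    ; _*_ = _⊗_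
    ; 0# = []
    ; 1# = [] ∷ []
    ; isCommutativeSemiring = isCommutativeSemiringˡ record
      { +-isCommutativeMonoid = ++-isCommutativeMonoid
      ; *-isCommutativeMonoid = isCommutativeMonoidˡ record
        { isSemigroup = record
          { isMagma = record
            { isEquivalence = Setoid.isEquivalence ≃-setoid
            ; ∙-cong = λ {ps} {qs} {rs} ps≃qs rs≃ss → ≃-trans (⊗-congˡ rs ps≃qs) (⊗-congʳ qs rs≃ss) }
          ; assoc = λ ps qs rs → ≃-reflexive (⊗-assoc ps qs rs) }
        ; identityˡ = λ ps → ≃-reflexive (⊗-identityˡ ps)
        ; comm = ⊗-comm }
      ; distribʳ = λ rs ps qs → ≃-reflexive (⊗-distribʳ rs ps qs)
      ; zeroˡ = λ _ → ≃-refl } }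

  ++-cancelˡ : LeftCancellative _≃_ _++_
  ++-cancelˡ _ _ _ = dropMiddle [] []

-- The ring of formal differences a − b, written (a , b), of a cancellative commutative semiring.
module DifferenceRing {c ℓ : Level} (S : CommutativeSemiring c ℓ)
  (+-cancelˡ : LeftCancellative (CommutativeSemiring._≈_ S) (CommutativeSemiring._+_ S)) where

  open CommutativeSemiring S

  open import Algebra.Solver.Ring.NaturalCoefficients.Default S
  open import Relation.Binary.Reasoning.Setoid setoid

  infix 4 _≈ᵈ_
  infixl 6 _+ᵈ_
  infixl 7 _*ᵈ_

  Difference : Set c
  Difference = Carrier × Carrier

  record _≈ᵈ_ (x y : Difference) : Set ℓ where
    constructor mk≈ᵈ
    field cross-sums : proj₁ x + proj₂ y ≈ proj₁ y + proj₂ x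
  open _≈ᵈ_ public

  _+ᵈ_ _*ᵈ_ : Difference → Difference → Difference
  (a , b) +ᵈ (c , d) = a + c , b + d
  (a , b) *ᵈ (c , d) = a * c + b * d , a * d + b * c

  -ᵈ_ : Difference → Difference
  -ᵈ (a , b) = b , a

  ≈ᵈ-trans : ∀ {x y z} → x ≈ᵈ y → y ≈ᵈ z → x ≈ᵈ z
  ≈ᵈ-trans {a , b} {c , d} {e , f} (mk≈ᵈ ad≈cb) (mk≈ᵈ cf≈ed) = mk≈ᵈ (+-cancelˡ (c + d) (a + f) (e + b) (begin
    (c + d) + (a + f) ≈⟨ solve 4 (λ a c d f → (c :+ d) :+ (a :+ f) := (a :+ d) :+ (c :+ f)) refl a c d f ⟩
    (a + d) + (c + f) ≈⟨ +-cong ad≈cb cf≈ed ⟩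
    (c + b) + (e + d) ≈⟨ solve 4 (λ b c d e → (c :+ b) :+ (e :+ d) := (c :+ d) :+ (e :+ b)) refl b c d e ⟩
    (c + d) + (e + b) ∎))

  +ᵈ-cong : ∀ {x y u v} → x ≈ᵈ y → u ≈ᵈ v → x +ᵈ u ≈ᵈ y +ᵈ v
  +ᵈ-cong {a , b} {c , d} {p , q} {r , s} (mk≈ᵈ ad≈cb) (mk≈ᵈ ps≈rq) = mk≈ᵈ (begin
    (a + p) + (d + s) ≈⟨ solve 4 (λ a p d s → (a :+ p) :+ (d :+ s) := (a :+ d) :+ (p :+ s)) refl a p d s ⟩
    (a + d) + (p + s) ≈⟨ +-cong ad≈cb ps≈rq ⟩
    (c + b) + (r + q) ≈⟨ solve 4 (λ b c q r → (c :+ b) :+ (r :+ q) := (c :+ r) :+ (b :+ q)) refl b c q r ⟩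
    (c + r) + (b + q) ∎)

  -ᵈ-cong : ∀ {x y} → x ≈ᵈ y → -ᵈ x ≈ᵈ -ᵈ y
  -ᵈ-cong {a , b} {c , d} (mk≈ᵈ ad≈cb) = mk≈ᵈ (trans (+-comm b c) (trans (sym ad≈cb) (+-comm a d)))

  *ᵈ-comm : ∀ x y → x *ᵈ y ≈ᵈ y *ᵈ x
  *ᵈ-comm (a , b) (c , d) = mk≈ᵈ (solve 4 (λ a b c d →
    (a :* c :+ b :* d) :+ (c :* b :+ d :* a) := (c :* a :+ d :* b) :+ (a :* d :+ b :* c)) refl a b c d)

  *ᵈ-congʳ : ∀ {x y} u → x ≈ᵈ y → x *ᵈ u ≈ᵈ y *ᵈ u
  *ᵈ-congʳ {a , b} {c , d} (p , q) (mk≈ᵈ ad≈cb) = mk≈ᵈ (begin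
    (a * p + b * q) + (c * q + d * p)
      ≈⟨ solve 6 (λ a b c d p q →
           (a :* p :+ b :* q) :+ (c :* q :+ d :* p) := (a :+ d) :* p :+ (c :+ b) :* q) refl a b c d p q ⟩
    (a + d) * p + (c + b) * q
      ≈⟨ +-cong (*-congʳ ad≈cb) (*-congʳ (sym ad≈cb)) ⟩
    (c + b) * p + (a + d) * q
      ≈⟨ solve 6 (λ a b c d p q →
           (c :+ b) :* p :+ (a :+ d) :* q := (c :* p :+ d :* q) :+ (a :* q :+ b :* p)) refl a b c d p q ⟩
    (c * p + d * q) + (a * q + b * p) ∎)

  *ᵈ-cong : ∀ {x y u v} → x ≈ᵈ y → u ≈ᵈ v → x *ᵈ u ≈ᵈ y *ᵈ v
  *ᵈ-cong {x} {y} {u} {v} x≈y u≈v =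
    ≈ᵈ-trans (*ᵈ-congʳ u x≈y) (≈ᵈ-trans (*ᵈ-comm y u) (≈ᵈ-trans (*ᵈ-congʳ y u≈v) (*ᵈ-comm v y)))

  +ᵈ-assoc : ∀ x y z → (x +ᵈ y) +ᵈ z ≈ᵈ x +ᵈ (y +ᵈ z)
  +ᵈ-assoc (a , b) (c , d) (e , f) = mk≈ᵈ (solve 6 (λ a b c d e f →
    (a :+ c :+ e) :+ (b :+ (d :+ f)) := (a :+ (c :+ e)) :+ (b :+ d :+ f)) refl a b c d e f)

  +ᵈ-comm : ∀ x y → x +ᵈ y ≈ᵈ y +ᵈ x
  +ᵈ-comm (a , b) (c , d) = mk≈ᵈ (solve 4 (λ a b c d → (a :+ c) :+ (d :+ b) := (c :+ a) :+ (b :+ d)) refl a b c d)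

  +ᵈ-identityˡ : ∀ x → (0# , 0#) +ᵈ x ≈ᵈ x
  +ᵈ-identityˡ (a , b) = mk≈ᵈ (solve 2 (λ a b → (con 0 :+ a) :+ b := a :+ (con 0 :+ b)) refl a b)

  +ᵈ-identityʳ : ∀ x → x +ᵈ (0# , 0#) ≈ᵈ x
  +ᵈ-identityʳ (a , b) = mk≈ᵈ (solve 2 (λ a b → (a :+ con 0) :+ b := a :+ (b :+ con 0)) refl a b)

  -ᵈ-inverseˡ : ∀ x → (-ᵈ x) +ᵈ x ≈ᵈ (0# , 0#)
  -ᵈ-inverseˡ (a , b) = mk≈ᵈ (solve 2 (λ a b → (b :+ a) :+ con 0 := con 0 :+ (a :+ b)) refl a b)

  -ᵈ-inverseʳ : ∀ x → x +ᵈ (-ᵈ x) ≈ᵈ (0# , 0#)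
  -ᵈ-inverseʳ (a , b) = mk≈ᵈ (solve 2 (λ a b → (a :+ b) :+ con 0 := con 0 :+ (b :+ a)) refl a b)

  *ᵈ-assoc : ∀ x y z → (x *ᵈ y) *ᵈ z ≈ᵈ x *ᵈ (y *ᵈ z)
  *ᵈ-assoc (a , b) (c , d) (e , f) = mk≈ᵈ (solve 6 (λ a b c d e f →
    ((a :* c :+ b :* d) :* e :+ (a :* d :+ b :* c) :* f) :+ (a :* (c :* f :+ d :* e) :+ b :* (c :* e :+ d :* f))
    := (a :* (c :* e :+ d :* f) :+ b :* (c :* f :+ d :* e)) :+ ((a :* c :+ b :* d) :* f :+ (a :* d :+ b :* c) :* e))
    refl a b c d e f)

  *ᵈ-identityˡ : ∀ x → (1# , 0#) *ᵈ x ≈ᵈ x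
  *ᵈ-identityˡ (a , b) = mk≈ᵈ (solve 2 (λ a b →
    (con 1 :* a :+ con 0 :* b) :+ b := a :+ (con 1 :* b :+ con 0 :* a)) refl a b)

  *ᵈ-identityʳ : ∀ x → x *ᵈ (1# , 0#) ≈ᵈ x
  *ᵈ-identityʳ (a , b) = mk≈ᵈ (solve 2 (λ a b →
    (a :* con 1 :+ b :* con 0) :+ b := a :+ (a :* con 0 :+ b :* con 1)) refl a b)

  *ᵈ-distribˡ : ∀ x y z → x *ᵈ (y +ᵈ z) ≈ᵈ x *ᵈ y +ᵈ x *ᵈ z
  *ᵈ-distribˡ (a , b) (c , d) (e , f) = mk≈ᵈ (solve 6 (λ a b c d e f →
    (a :* (c :+ e) :+ b :* (d :+ f)) :+ ((a :* d :+ b :* c) :+ (a :* f :+ b :* e))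
    := ((a :* c :+ b :* d) :+ (a :* e :+ b :* f)) :+ (a :* (d :+ f) :+ b :* (c :+ e)))
    refl a b c d e f)

  *ᵈ-distribʳ : ∀ x y z → (y +ᵈ z) *ᵈ x ≈ᵈ y *ᵈ x +ᵈ z *ᵈ x
  *ᵈ-distribʳ (a , b) (c , d) (e , f) = mk≈ᵈ (solve 6 (λ a b c d e f →
    ((c :+ e) :* a :+ (d :+ f) :* b) :+ ((c :* b :+ d :* a) :+ (e :* b :+ f :* a))
    := ((c :* a :+ d :* b) :+ (e :* a :+ f :* b)) :+ ((c :+ e) :* b :+ (d :+ f) :* a))
    refl a b c d e f)

  commutativeRing : CommutativeRing c ℓ
  commutativeRing = record
    { Carrier = Difference
    ; _≈_ = _≈ᵈ_
    ; _+_ = _+ᵈ_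
    ; _*_ = _*ᵈ_
    ; -_ = -ᵈ_
    ; 0# = 0# , 0#
    ; 1# = 1# , 0#
    ; isCommutativeRing = record
      { isRing = record
        { +-isAbelianGroup = record
          { isGroup = record
            { isMonoid = record
              { isSemigroup = record
                { isMagma = record
                  { isEquivalence = record
                    { refl = mk≈ᵈ refl
                    ; sym = λ { (mk≈ᵈ ad≈cb) → mk≈ᵈ (sym ad≈cb) }
                    ; trans = ≈ᵈ-trans }
                  ; ∙-cong = +ᵈ-cong }
                ; assoc = +ᵈ-assoc }
              ; identity = +ᵈ-identityˡ , +ᵈ-identityʳ }
            ; inverse = -ᵈ-inverseˡ , -ᵈ-inverseʳ
            ; ⁻¹-cong = -ᵈ-cong }
          ; comm = +ᵈ-comm }
        ; *-cong = *ᵈ-cong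
        ; *-assoc = *ᵈ-assoc
        ; *-identity = *ᵈ-identityˡ , *ᵈ-identityʳ
        ; distrib = *ᵈ-distribˡ , *ᵈ-distribʳ }
      ; *-comm = *ᵈ-comm } }

module FreeCommutativeRing {a : Level} (A : Set a) where
  open FreeCommutativeSemiring A public
  open DifferenceRing commutativeSemiring ++-cancelˡ public

  embed : Polynomial → Difference
  embed ps = ps , []

  var : A → Difference
  var x = embed ((x ∷ []) ∷ [])

  var-* : ∀ x ps qs → var x *ᵈ (ps , qs) ≈ᵈ (map (x ∷_) ps , map (x ∷_) qs)
  var-* x ps qs = mk≈ᵈ (≃-reflexive (≡.trans (cong (_++ map (x ∷_) qs) (dropUnits ps))
                                             (cong (map (x ∷_) ps ++_) (≡.sym (dropUnits qs)))))
    where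
    dropUnits : ∀ ps → (map (x ∷_) ps ++ []) ++ [] ≡ map (x ∷_) ps
    dropUnits ps = ≡.trans (List.++-identityʳ _) (List.++-identityʳ _)

-- Truncated polynomials c₀ + c₁ ε + c₂ ε² over R, computed modulo ε³.
module SecondOrderJet {c ℓ : Level} (R : CommutativeRing c ℓ) where
  open CommutativeRing R
  open import Algebra.Solver.Ring.NaturalCoefficients.Default commutativeSemiring
  open import Algebra.Properties.Ring ring using (-0#≈0#)

  infix 4 _≈ʲ_
  infixl 6 _+ʲ_
  infixl 7 _*ʲ_

  record Jet : Set c where
    constructor jet
    field c₀ c₁ c₂ : Carrier
  open Jet public

  record _≈ʲ_ (x y : Jet) : Set ℓ where
    constructor mk≈ʲ
    field c₀-≈ : c₀ x ≈ c₀ y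
          c₁-≈ : c₁ x ≈ c₁ y
          c₂-≈ : c₂ x ≈ c₂ y
  open _≈ʲ_ public

  _+ʲ_ _*ʲ_ : Jet → Jet → Jet
  jet a₀ a₁ a₂ +ʲ jet b₀ b₁ b₂ = jet (a₀ + b₀) (a₁ + b₁) (a₂ + b₂)
  jet a₀ a₁ a₂ *ʲ jet b₀ b₁ b₂ = jet (a₀ * b₀) (a₀ * b₁ + a₁ * b₀) (a₀ * b₂ + a₁ * b₁ + a₂ * b₀)

  -ʲ_ : Jet → Jet
  -ʲ jet a₀ a₁ a₂ = jet (- a₀) (- a₁) (- a₂)

  *ʲ-cong : ∀ {x y u v} → x ≈ʲ y → u ≈ʲ v → x *ʲ u ≈ʲ y *ʲ v
  *ʲ-cong {jet _ _ _} {jet _ _ _} {jet _ _ _} {jet _ _ _} (mk≈ʲ p₀ p₁ p₂) (mk≈ʲ q₀ q₁ q₂) = mk≈ʲ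
    (*-cong p₀ q₀)
    (+-cong (*-cong p₀ q₁) (*-cong p₁ q₀))
    (+-cong (+-cong (*-cong p₀ q₂) (*-cong p₁ q₁)) (*-cong p₂ q₀))

  *ʲ-comm : ∀ x y → x *ʲ y ≈ʲ y *ʲ x
  *ʲ-comm (jet a₀ a₁ a₂) (jet b₀ b₁ b₂) = mk≈ʲ
    (*-comm a₀ b₀)
    (solve 4 (λ a₀ a₁ b₀ b₁ → a₀ :* b₁ :+ a₁ :* b₀ := b₀ :* a₁ :+ b₁ :* a₀) refl a₀ a₁ b₀ b₁)
    (solve 6 (λ a₀ a₁ a₂ b₀ b₁ b₂ →
        a₀ :* b₂ :+ a₁ :* b₁ :+ a₂ :* b₀ := b₀ :* a₂ :+ b₁ :* a₁ :+ b₂ :* a₀) refl a₀ a₁ a₂ b₀ b₁ b₂)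

  *ʲ-assoc : ∀ x y z → (x *ʲ y) *ʲ z ≈ʲ x *ʲ (y *ʲ z)
  *ʲ-assoc (jet a₀ a₁ a₂) (jet b₀ b₁ b₂) (jet c₀ c₁ c₂) = mk≈ʲ
    (*-assoc a₀ b₀ c₀)
    (solve 6 (λ a₀ a₁ b₀ b₁ c₀ c₁ →
        a₀ :* b₀ :* c₁ :+ (a₀ :* b₁ :+ a₁ :* b₀) :* c₀ := a₀ :* (b₀ :* c₁ :+ b₁ :* c₀) :+ a₁ :* (b₀ :* c₀))
        refl a₀ a₁ b₀ b₁ c₀ c₁)
    (solve 9 (λ a₀ a₁ a₂ b₀ b₁ b₂ c₀ c₁ c₂ →
        a₀ :* b₀ :* c₂ :+ (a₀ :* b₁ :+ a₁ :* b₀) :* c₁ :+ (a₀ :* b₂ :+ a₁ :* b₁ :+ a₂ :* b₀) :* c₀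
        := a₀ :* (b₀ :* c₂ :+ b₁ :* c₁ :+ b₂ :* c₀) :+ a₁ :* (b₀ :* c₁ :+ b₁ :* c₀) :+ a₂ :* (b₀ :* c₀))
        refl a₀ a₁ a₂ b₀ b₁ b₂ c₀ c₁ c₂)

  *ʲ-identityˡ : ∀ x → jet 1# 0# 0# *ʲ x ≈ʲ x
  *ʲ-identityˡ (jet a₀ a₁ a₂) = mk≈ʲ
    (*-identityˡ a₀)
    (solve 2 (λ a₀ a₁ → con 1 :* a₁ :+ con 0 :* a₀ := a₁) refl a₀ a₁)
    (solve 3 (λ a₀ a₁ a₂ → con 1 :* a₂ :+ con 0 :* a₁ :+ con 0 :* a₀ := a₂) refl a₀ a₁ a₂)

  *ʲ-identityʳ : ∀ x → x *ʲ jet 1# 0# 0# ≈ʲ x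
  *ʲ-identityʳ (jet a₀ a₁ a₂) = mk≈ʲ
    (*-identityʳ a₀)
    (solve 2 (λ a₀ a₁ → a₀ :* con 0 :+ a₁ :* con 1 := a₁) refl a₀ a₁)
    (solve 3 (λ a₀ a₁ a₂ → a₀ :* con 0 :+ a₁ :* con 0 :+ a₂ :* con 1 := a₂) refl a₀ a₁ a₂)

  *ʲ-distribˡ : ∀ x y z → x *ʲ (y +ʲ z) ≈ʲ x *ʲ y +ʲ x *ʲ z
  *ʲ-distribˡ (jet a₀ a₁ a₂) (jet b₀ b₁ b₂) (jet c₀ c₁ c₂) = mk≈ʲ
    (distribˡ a₀ b₀ c₀)
    (solve 6 (λ a₀ a₁ b₀ b₁ c₀ c₁ →
        a₀ :* (b₁ :+ c₁) :+ a₁ :* (b₀ :+ c₀) := (a₀ :* b₁ :+ a₁ :* b₀) :+ (a₀ :* c₁ :+ a₁ :* c₀))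
        refl a₀ a₁ b₀ b₁ c₀ c₁)
    (solve 9 (λ a₀ a₁ a₂ b₀ b₁ b₂ c₀ c₁ c₂ →
        a₀ :* (b₂ :+ c₂) :+ a₁ :* (b₁ :+ c₁) :+ a₂ :* (b₀ :+ c₀)
        := (a₀ :* b₂ :+ a₁ :* b₁ :+ a₂ :* b₀) :+ (a₀ :* c₂ :+ a₁ :* c₁ :+ a₂ :* c₀))
        refl a₀ a₁ a₂ b₀ b₁ b₂ c₀ c₁ c₂)

  *ʲ-distribʳ : ∀ x y z → (y +ʲ z) *ʲ x ≈ʲ y *ʲ x +ʲ z *ʲ x
  *ʲ-distribʳ (jet a₀ a₁ a₂) (jet b₀ b₁ b₂) (jet c₀ c₁ c₂) = mk≈ʲ
    (distribʳ a₀ b₀ c₀)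
    (solve 6 (λ a₀ a₁ b₀ b₁ c₀ c₁ →
        (b₀ :+ c₀) :* a₁ :+ (b₁ :+ c₁) :* a₀ := (b₀ :* a₁ :+ b₁ :* a₀) :+ (c₀ :* a₁ :+ c₁ :* a₀))
        refl a₀ a₁ b₀ b₁ c₀ c₁)
    (solve 9 (λ a₀ a₁ a₂ b₀ b₁ b₂ c₀ c₁ c₂ →
        (b₀ :+ c₀) :* a₂ :+ (b₁ :+ c₁) :* a₁ :+ (b₂ :+ c₂) :* a₀
        := (b₀ :* a₂ :+ b₁ :* a₁ :+ b₂ :* a₀) :+ (c₀ :* a₂ :+ c₁ :* a₁ :+ c₂ :* a₀))
        refl a₀ a₁ a₂ b₀ b₁ b₂ c₀ c₁ c₂)

  commutativeRing : CommutativeRing c ℓ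
  commutativeRing = record
    { Carrier = Jet
    ; _≈_ = _≈ʲ_
    ; _+_ = _+ʲ_
    ; _*_ = _*ʲ_
    ; -_ = -ʲ_
    ; 0# = jet 0# 0# 0#
    ; 1# = jet 1# 0# 0#
    ; isCommutativeRing = record
      { isRing = record
        { +-isAbelianGroup = record
          { isGroup = record
            { isMonoid = record
              { isSemigroup = record
                { isMagma = record
                  { isEquivalence = record
                    { refl = mk≈ʲ refl refl refl
                    ; sym = λ { (mk≈ʲ p₀ p₁ p₂) → mk≈ʲ (sym p₀) (sym p₁) (sym p₂) }
                    ; trans = λ { (mk≈ʲ p₀ p₁ p₂) (mk≈ʲ q₀ q₁ q₂) →
                        mk≈ʲ (trans p₀ q₀) (trans p₁ q₁) (trans p₂ q₂) } }
                  ; ∙-cong = λ { (mk≈ʲ p₀ p₁ p₂) (mk≈ʲ q₀ q₁ q₂) →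
                      mk≈ʲ (+-cong p₀ q₀) (+-cong p₁ q₁) (+-cong p₂ q₂) } }
                ; assoc = λ _ _ _ → mk≈ʲ (+-assoc _ _ _) (+-assoc _ _ _) (+-assoc _ _ _) }
              ; identity = (λ _ → mk≈ʲ (+-identityˡ _) (+-identityˡ _) (+-identityˡ _))
                         , (λ _ → mk≈ʲ (+-identityʳ _) (+-identityʳ _) (+-identityʳ _)) }
            ; inverse = (λ _ → mk≈ʲ (-‿inverseˡ _) (-‿inverseˡ _) (-‿inverseˡ _))
                      , (λ _ → mk≈ʲ (-‿inverseʳ _) (-‿inverseʳ _) (-‿inverseʳ _))
            ; ⁻¹-cong = λ { (mk≈ʲ p₀ p₁ p₂) → mk≈ʲ (-‿cong p₀) (-‿cong p₁) (-‿cong p₂) } }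
          ; comm = λ _ _ → mk≈ʲ (+-comm _ _) (+-comm _ _) (+-comm _ _) }
        ; *-cong = *ʲ-cong
        ; *-assoc = *ʲ-assoc
        ; *-identity = *ʲ-identityˡ , *ʲ-identityʳ
        ; distrib = *ʲ-distribˡ , *ʲ-distribʳ }
      ; *-comm = *ʲ-comm } }

  y≈0⇒x-y≈x : ∀ {x y} → y ≈ 0# → x - y ≈ x
  y≈0⇒x-y≈x y≈0 = trans (+-congˡ (trans (-‿cong y≈0) -0#≈0#)) (+-identityʳ _)

  -- One step a X − (ε b)² Y of the tridiagonal recurrence, reduced modulo ε³.
  jet-recurrence : ∀ a b x y →
    jet a 0# 0# *ʲ x +ʲ -ʲ (jet 0# b 0# *ʲ jet 0# b 0# *ʲ y) ≈ʲ jet (a * c₀ x) (a * c₁ x) (a * c₂ x - b * b * c₀ y)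
  jet-recurrence a b (jet x₀ x₁ x₂) (jet y₀ y₁ y₂) = mk≈ʲ
    (y≈0⇒x-y≈x (solve 1 (λ y₀ → con 0 :* con 0 :* y₀ := con 0) refl y₀))
    (trans (y≈0⇒x-y≈x (solve 3 (λ b y₀ y₁ → con 0 :* con 0 :* y₁ :+ (con 0 :* b :+ b :* con 0) :* y₀ := con 0)
                                refl b y₀ y₁))
            (solve 3 (λ a x₀ x₁ → a :* x₁ :+ con 0 :* x₀ := a :* x₁) refl a x₀ x₁))
    (+-cong (solve 4 (λ a x₀ x₁ x₂ → a :* x₂ :+ con 0 :* x₁ :+ con 0 :* x₀ := a :* x₂) refl a x₀ x₁ x₂)
             (-‿cong (solve 4 (λ b y₀ y₁ y₂ →
                con 0 :* con 0 :* y₂ :+ (con 0 :* b :+ b :* con 0) :* y₁ :+ (con 0 :* con 0 :+ b :* b :+ con 0 :* con 0) :* y₀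
                := b :* b :* y₀) refl b y₀ y₁ y₂)))

module Determinant (R : CommutativeRing 0ℓ 0ℓ) where
  open CommutativeRing R hiding (zero)
  open import Algebra.Properties.Ring ring using (-1*x≈-x)
  open import Relation.Binary.Reasoning.Setoid setoid

  sumFin-cong : ∀ n {f g : Fin n → Carrier} → (∀ j → f j ≈ g j) → sumFin R n f ≈ sumFin R n g
  sumFin-cong zero    f≈g = refl
  sumFin-cong (suc n) f≈g = +-cong (f≈g zero) (sumFin-cong n (f≈g ∘ suc))

  sumFin-zero : ∀ n {f : Fin n → Carrier} → (∀ j → f j ≈ 0#) → sumFin R n f ≈ 0#
  sumFin-zero n f≈0 = trans (sumFin-cong n f≈0) (sumFin-0# n)
    where
    sumFin-0# : ∀ n → sumFin R n (λ _ → 0#) ≈ 0#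
    sumFin-0# zero    = refl
    sumFin-0# (suc n) = trans (+-congˡ (sumFin-0# n)) (+-identityʳ 0#)

  det-cong : ∀ n {A B : Fin n → Fin n → Carrier} → (∀ i j → A i j ≈ B i j) → det R n A ≈ det R n B
  det-cong zero    A≈B = refl
  det-cong (suc n) A≈B = sumFin-cong (suc n) λ j →
    *-congˡ {signR R (toℕ j)} (*-cong (A≈B zero j) (det-cong n λ i k → A≈B (suc i) (punchIn j k)))

  det-cornerExpansion : ∀ n (A : Fin (suc n) → Fin (suc n) → Carrier) → (∀ i → A (suc i) zero ≈ 0#) →
                    det R (suc n) A ≈ A zero zero * det R n (λ i j → A (suc i) (suc j))
  det-cornerExpansion n A column≈0 = trans (+-cong (*-identityˡ _) (laterTerms≈0 n A column≈0)) (+-identityʳ _)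
    where
    -- The minors of the later terms of the first-row expansion have a zero first column.
    laterTerms≈0 : ∀ n (A : Fin (suc n) → Fin (suc n) → Carrier) → (∀ i → A (suc i) zero ≈ 0#) →
      sumFin R n (λ j → signR R (toℕ (suc j)) * (A zero (suc j) * det R n (λ i k → A (suc i) (punchIn (suc j) k)))) ≈ 0#
    laterTerms≈0 zero    A column≈0 = refl
    laterTerms≈0 (suc n) A column≈0 = sumFin-zero (suc n) λ j → begin
      signR R (toℕ (suc j)) * (A zero (suc j) * det R (suc n) (λ i k → A (suc i) (punchIn (suc j) k)))
        ≈⟨ *-congˡ (*-congˡ (det-cornerExpansion n (λ i k → A (suc i) (punchIn (suc j) k)) (column≈0 ∘ suc))) ⟩
      signR R (toℕ (suc j)) * (A zero (suc j) * (A (suc zero) zero * _))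
        ≈⟨ *-congˡ (*-congˡ (trans (*-congʳ (column≈0 zero)) (zeroˡ _))) ⟩
      signR R (toℕ (suc j)) * (A zero (suc j) * 0#)
        ≈⟨ trans (*-congˡ (zeroʳ _)) (zeroʳ _) ⟩
      0# ∎

  det-tridiagonal : ∀ m (A : Fin (suc (suc m)) → Fin (suc (suc m)) → Carrier) →
    (∀ j → A zero (suc (suc j)) ≈ 0#) → (∀ i → A (suc (suc i)) zero ≈ 0#) →
    det R (suc (suc m)) A ≈
      A zero zero * det R (suc m) (λ i j → A (suc i) (suc j))
      - A zero (suc zero) * A (suc zero) zero * det R m (λ i j → A (suc (suc i)) (suc (suc j)))
  det-tridiagonal m A row≈0 column≈0 = begin
    det R (suc (suc m)) A
      ≈⟨ +-cong (*-identityˡ _) (+-cong (-1*x≈-x _) (sumFin-zero m farTerm≈0)) ⟩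
    A zero zero * det₁ + (- (A zero (suc zero) * det R (suc m) A′) + 0#)
      ≈⟨ +-congˡ (trans (+-identityʳ _) (-‿cong (*-congˡ (det-cornerExpansion m A′ column≈0)))) ⟩
    A zero zero * det₁ + - (A zero (suc zero) * (A (suc zero) zero * det₂))
      ≈⟨ +-congˡ (-‿cong (sym (*-assoc _ _ _))) ⟩
    A zero zero * det₁ - A zero (suc zero) * A (suc zero) zero * det₂ ∎
    where
    det₁ = det R (suc m) (λ i j → A (suc i) (suc j))
    det₂ = det R m (λ i j → A (suc (suc i)) (suc (suc j)))
    A′ : Fin (suc m) → Fin (suc m) → Carrier
    A′ i k = A (suc i) (punchIn (suc zero) k)
    farTerm≈0 : ∀ j → signR R (toℕ (suc (suc j))) *
                      (A zero (suc (suc j)) * det R (suc m) (λ i k → A (suc i) (punchIn (suc (suc j)) k))) ≈ 0#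
    farTerm≈0 j = trans (*-congˡ (trans (*-congʳ (row≈0 j)) (zeroˡ _))) (zeroʳ _)

module _ {V E : Set} where

  tail : ∀ {n} → ColoredPath V E (suc n) → ColoredPath V E n
  tail P = record { vcol = vcol P ∘ suc ; ecol = ecol P ∘ suc }

  triColor-suc : ∀ n (d : Fin (suc (suc n)) → V) (e : Fin (suc n) → E) i j →
                 triColor (suc n) d e (suc i) (suc j) ≡ triColor n (d ∘ suc) (e ∘ suc) i j
  triColor-suc n d e zero    zero    = ≡.refl
  triColor-suc n d e zero    (suc j) = ≡.refl
  triColor-suc n d e (suc i) zero    = ≡.refl
  triColor-suc n d e (suc i) (suc j) = ≡.refl

  module _ (R : CommutativeRing 0ℓ 0ℓ) (t : V ⊎ E → CommutativeRing.Carrier R) where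
    open CommutativeRing R hiding (zero)
    open Determinant R
    open import Relation.Binary.Reasoning.Setoid setoid

    K-tail : ∀ {n} (P : ColoredPath V E (suc n)) i j → K R P t (suc i) (suc j) ≡ K R (tail P) t i j
    K-tail {n} P i j = ≡.cong (maybe t 0#) (triColor-suc n (vcol P) (ecol P) i j)

    det-K-recurrence : ∀ m (P : ColoredPath V E (suc m)) →
      det R (suc (suc m)) (K R P t) ≈
        t (inj₁ (vcol P zero)) * det R (suc m) (K R (tail P) t)
        - t (inj₂ (ecol P zero)) * t (inj₂ (ecol P zero)) * det R m (λ i j → K R (tail P) t (suc i) (suc j))
    det-K-recurrence m P = begin
      det R (suc (suc m)) (K R P t)
        ≈⟨ det-tridiagonal m (K R P t) (λ _ → refl) (λ _ → refl) ⟩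
      _ - _ * _ * det R m (λ i j → K R P t (suc (suc i)) (suc (suc j)))
        ≈⟨ +-cong (*-congˡ (det-cong (suc m) λ i j → reflexive (K-tail P i j)))
                  (-‿cong (*-congˡ (det-cong m λ i j → reflexive (K-tail P (suc i) (suc j))))) ⟩
      _ ∎

module _ {V E : Set} where
  open FreeCommutativeRing (V ⊎ E)
    using (Monomial; _≃_; ≃-sym; embed; var; var-*; -ᵈ_; mk≈ᵈ; cross-sums)
    renaming (commutativeRing to ℤ[V⊎E])
  open SecondOrderJet ℤ[V⊎E] using (Jet; jet; c₀; c₁; c₂; _≈ʲ_; mk≈ʲ; c₀-≈; c₂-≈; jet-recurrence)
  open CommutativeRing ℤ[V⊎E] hiding (zero)
  open PermutationSetoidProperties (↭-setoid {A = V ⊎ E}) using (Any-resp-↭)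

  ℤ[V⊎E][ε] : CommutativeRing 0ℓ 0ℓ
  ℤ[V⊎E][ε] = SecondOrderJet.commutativeRing ℤ[V⊎E]
  private module J = CommutativeRing ℤ[V⊎E][ε]

  vertexMonomial : List V → Monomial
  vertexMonomial = map inj₁

  otherVertexColors : ∀ {n} → ColoredPath V E n → Fin n → List V
  otherVertexColors P zero    = tabulate (λ i → vcol P (suc (suc i)))
  otherVertexColors P (suc k) = vcol P zero ∷ otherVertexColors (tail P) k

  edgeMonomial : ∀ {n} → ColoredPath V E n → Fin n → Monomial
  edgeMonomial P k = inj₂ (ecol P k) ∷ inj₂ (ecol P k) ∷ vertexMonomial (otherVertexColors P k)

  εColoring : V ⊎ E → Jet
  εColoring (inj₁ v) = jet (var (inj₁ v)) 0# 0#
  εColoring (inj₂ e) = jet 0# (var (inj₂ e)) 0#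

  expansion : ∀ {n} → ColoredPath V E n → Jet
  expansion P = jet (embed (vertexMonomial (tabulate (vcol P)) ∷ [])) 0# (-ᵈ embed (tabulate (edgeMonomial P)))

  edgeMonomials-suc : ∀ {m} (P : ColoredPath V E (suc m)) →
    tabulate (edgeMonomial P) ≃ map (inj₁ (vcol P zero) ∷_) (tabulate (edgeMonomial (tail P))) ++ edgeMonomial P zero ∷ []
  edgeMonomials-suc P = begin
    edgeMonomial P zero ∷ tabulate (edgeMonomial P ∘ suc)
      ≋⟨ ↭.refl Pointwise.∷ Pointwise.tabulate⁺ (λ k → shift v (inj₂ (ecol P (suc k)) ∷ inj₂ (ecol P (suc k)) ∷ []) _)
      ⟩
    edgeMonomial P zero ∷ tabulate ((v ∷_) ∘ edgeMonomial (tail P))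
      ≡⟨ cong (edgeMonomial P zero ∷_) (List.map-tabulate (edgeMonomial (tail P)) (v ∷_)) ⟨
    edgeMonomial P zero ∷ map (v ∷_) (tabulate (edgeMonomial (tail P)))
      ↭⟨ ++-comm (edgeMonomial P zero ∷ []) _ ⟩
    map (v ∷_) (tabulate (edgeMonomial (tail P))) ++ edgeMonomial P zero ∷ [] ∎
    where
    open PermutationSetoid.PermutationReasoning (↭-setoid {A = V ⊎ E})
    open PermutationSetoidProperties (↭-setoid {A = V ⊎ E}) using (++-comm)
    v = inj₁ (vcol P zero)

  expansion-recurrence : ∀ {m} (P : ColoredPath V E (suc m)) {D₁ D₂ : Jet} →
    D₁ ≈ʲ expansion (tail P) → c₀ D₂ ≈ embed (vertexMonomial (tabulate (λ i → vcol P (suc (suc i)))) ∷ []) →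
    let a = var (inj₁ (vcol P zero)); b = var (inj₂ (ecol P zero)) in
    jet (a * c₀ D₁) (a * c₁ D₁) (a * c₂ D₁ - b * b * c₀ D₂) ≈ʲ expansion P
  expansion-recurrence P {D₁} {D₂} (mk≈ʲ D₁≈₀ D₁≈₁ D₁≈₂) D₂≈₀ = mk≈ʲ
      (begin
        a * c₀ D₁                    ≈⟨ *-congˡ {a} D₁≈₀ ⟩
        a * c₀ (expansion (tail P))  ≈⟨ var-* (inj₁ (vcol P zero)) (vertexMonomial (tabulate (vcol (tail P))) ∷ []) [] ⟩
        c₀ (expansion P)             ∎)
      (begin
        a * c₁ D₁  ≈⟨ *-congˡ {a} D₁≈₁ ⟩
        a * 0#     ≈⟨ zeroʳ a ⟩
        0#         ∎)
      (begin
        a * c₂ D₁ - b * b * c₀ D₂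
          ≈⟨ +-cong (*-congˡ {a} D₁≈₂) (-‿cong (*-congˡ {b * b} D₂≈₀)) ⟩
        a * c₂ (expansion (tail P)) - b * b * embed (vertexMonomial (tabulate (λ i → vcol P (suc (suc i)))) ∷ [])
        -- b * b * embed (m ∷ []) computes to embed ((inj₂ e ∷ inj₂ e ∷ m) ∷ []).
          ≈⟨ +-congʳ (var-* (inj₁ (vcol P zero)) [] (tabulate (edgeMonomial (tail P)))) ⟩
        -ᵈ embed (map (inj₁ (vcol P zero) ∷_) (tabulate (edgeMonomial (tail P)))) - embed (edgeMonomial P zero ∷ [])
          ≈⟨ mk≈ᵈ (edgeMonomials-suc P) ⟩
        c₂ (expansion P) ∎)
    where
    open import Relation.Binary.Reasoning.Setoid setoid
    a = var (inj₁ (vcol P zero))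
    b = var (inj₂ (ecol P zero))

  det-K≈expansion : ∀ n (P : ColoredPath V E n) → det ℤ[V⊎E][ε] (suc n) (K ℤ[V⊎E][ε] P εColoring) ≈ʲ expansion P
  c₀-det-K-minor : ∀ m (P : ColoredPath V E m) →
    c₀ (det ℤ[V⊎E][ε] m (λ i j → K ℤ[V⊎E][ε] P εColoring (suc i) (suc j)))
      ≈ embed (vertexMonomial (tabulate (vcol P ∘ suc)) ∷ [])

  det-K≈expansion zero P = begin
    J.1# J.* (v J.* J.1#) J.+ J.0#  ≈⟨ J.+-identityʳ (J.1# J.* (v J.* J.1#)) ⟩
    J.1# J.* (v J.* J.1#)           ≈⟨ J.*-identityˡ (v J.* J.1#) ⟩
    v J.* J.1#                      ≈⟨ J.*-identityʳ v ⟩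
    v                               ∎
    where
    open import Relation.Binary.Reasoning.Setoid J.setoid
    v = εColoring (inj₁ (vcol P zero))
  det-K≈expansion (suc m) P = begin
    det ℤ[V⊎E][ε] (suc (suc m)) (K ℤ[V⊎E][ε] P εColoring)
      ≈⟨ det-K-recurrence ℤ[V⊎E][ε] εColoring m P ⟩
    εColoring (inj₁ (vcol P zero)) J.* D₁ J.- εColoring (inj₂ (ecol P zero)) J.* εColoring (inj₂ (ecol P zero)) J.* D₂
      ≈⟨ jet-recurrence a b D₁ D₂ ⟩
    jet (a * c₀ D₁) (a * c₁ D₁) (a * c₂ D₁ - b * b * c₀ D₂)
      ≈⟨ expansion-recurrence P {D₂ = D₂} (det-K≈expansion m (tail P)) (c₀-det-K-minor m (tail P)) ⟩
    expansion P ∎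
    where
    open import Relation.Binary.Reasoning.Setoid J.setoid
    a = var (inj₁ (vcol P zero))
    b = var (inj₂ (ecol P zero))
    D₁ = det ℤ[V⊎E][ε] (suc m) (K ℤ[V⊎E][ε] (tail P) εColoring)
    D₂ = det ℤ[V⊎E][ε] m (λ i j → K ℤ[V⊎E][ε] (tail P) εColoring (suc i) (suc j))

  c₀-det-K-minor zero    P = refl {1#}
  c₀-det-K-minor (suc m) P = begin
    c₀ (det ℤ[V⊎E][ε] (suc m) (λ i j → K ℤ[V⊎E][ε] P εColoring (suc i) (suc j)))
      ≈⟨ c₀-≈ (Determinant.det-cong ℤ[V⊎E][ε] (suc m) λ i j → J.reflexive (K-tail ℤ[V⊎E][ε] εColoring P i j)) ⟩
    c₀ (det ℤ[V⊎E][ε] (suc m) (K ℤ[V⊎E][ε] (tail P) εColoring))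
      ≈⟨ c₀-≈ (det-K≈expansion m (tail P)) ⟩
    c₀ (expansion (tail P)) ∎
    where open import Relation.Binary.Reasoning.Setoid setoid

  DetPolyEq⇒expansion-≈ : ∀ {n} (P Q : ColoredPath V E n) → DetPolyEq P Q → expansion P ≈ʲ expansion Q
  DetPolyEq⇒expansion-≈ {n} P Q same =
    J.trans (J.sym (det-K≈expansion n P)) (J.trans (same ℤ[V⊎E][ε] εColoring) (det-K≈expansion n Q))

  vertexColors-↭ : ∀ {n} (P Q : ColoredPath V E n) → DetPolyEq P Q → tabulate (vcol P) ↭ tabulate (vcol Q)
  vertexColors-↭ P Q same = map⁻-retract {f = isInj₁} (λ _ → ≡.refl)
    (↭ₛ-singleton⁻ ↭-setoid (cross-sums (c₀-≈ (DetPolyEq⇒expansion-≈ P Q same))))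

  edgeMonomials-≃ : ∀ {n} (P Q : ColoredPath V E n) → DetPolyEq P Q → tabulate (edgeMonomial P) ≃ tabulate (edgeMonomial Q)
  edgeMonomials-≃ P Q same = ≃-sym (cross-sums (c₂-≈ (DetPolyEq⇒expansion-≈ P Q same)))

  vertexPart-edgeMonomial : ∀ {n} (P : ColoredPath V E n) k → mapMaybe isInj₁ (edgeMonomial P k) ≡ otherVertexColors P k
  vertexPart-edgeMonomial P k = List.mapMaybeIsInj₁∘mapInj₁ (otherVertexColors P k)

  edgePart-edgeMonomial : ∀ {n} (P : ColoredPath V E n) k → mapMaybe isInj₂ (edgeMonomial P k) ≡ ecol P k ∷ ecol P k ∷ []
  edgePart-edgeMonomial P k = cong (λ es → ecol P k ∷ ecol P k ∷ es) (List.mapMaybeIsInj₂∘mapInj₁ (otherVertexColors P k))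

  tabulate-vcol↭others++ends : ∀ {n} (P : ColoredPath V E n) k → tabulate (vcol P) ↭ otherVertexColors P k ++ endColors P k
  tabulate-vcol↭others++ends P zero    = ↭.++-comm (endColors P zero) (otherVertexColors P zero)
  tabulate-vcol↭others++ends P (suc k) = ↭.prep (vcol P zero) (tabulate-vcol↭others++ends (tail P) k)

  IsEdgeMonomial : Monomial → Set
  IsEdgeMonomial m = ∃ λ e → mapMaybe isInj₂ m ↭ e ∷ e ∷ []

  edgeColor : Monomial → Maybe E
  edgeColor = head ∘ mapMaybe isInj₂

  edgeColors-↭ : ∀ {n} (P Q : ColoredPath V E n) → tabulate (edgeMonomial P) ≃ tabulate (edgeMonomial Q) →
                 tabulate (ecol P) ↭ tabulate (ecol Q)
  edgeColors-↭ P Q edges = map⁻-retract {f = λ e → e} (λ _ → ≡.refl)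
    (subst₂ _↭_ (edgeColors P) (edgeColors Q)
      (map⁺-All ↭-setoid isEdgeMonomial-resp edgeColor-cong
        (All.tabulate⁺ λ k → ecol P k , ↭-reflexive (edgePart-edgeMonomial P k)) edges))
    where
    isEdgeMonomial-resp : IsEdgeMonomial Respects _↭_
    isEdgeMonomial-resp m↭m′ (e , p) = e , ↭-trans (↭-sym (mapMaybe-↭ isInj₂ m↭m′)) p
    edgeColor-cong : ∀ {m m′} → IsEdgeMonomial m → m ↭ m′ → edgeColor m ≡ edgeColor m′
    edgeColor-cong (e , p) m↭m′ =
      ≡.trans (head-↭-doubleton p) (≡.sym (head-↭-doubleton (proj₂ (isEdgeMonomial-resp m↭m′ (e , p)))))
    edgeColors : ∀ (R : ColoredPath V E _) → map edgeColor (tabulate (edgeMonomial R)) ≡ map just (tabulate (ecol R))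
    edgeColors R = ≡.trans (List.map-tabulate (edgeMonomial R) edgeColor) (≡.sym (List.map-tabulate (ecol R) just))

  edgesMatched : ∀ {n} (P Q : ColoredPath V E n) → tabulate (vcol P) ↭ tabulate (vcol Q) →
                 tabulate (edgeMonomial P) ≃ tabulate (edgeMonomial Q) → EdgesMatched P Q
  edgesMatched P Q vertices edges k
    with l , k↭l ← Any.tabulate⁻ (Any-resp-↭ (λ m↭m′ k↭m → ↭-trans k↭m m↭m′) edges (Any.tabulate⁺ k ↭-refl))
    = l , sameEdgeColor , sameEndColors
    where
    sameEdgeColor : ecol Q l ≡ ecol P k
    sameEdgeColor = ≡.sym (∈-doubleton (∈-resp-↭
      (subst₂ _↭_ (edgePart-edgeMonomial P k) (edgePart-edgeMonomial Q l) (mapMaybe-↭ isInj₂ k↭l)) (here ≡.refl)))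
    sameOthers : otherVertexColors P k ↭ otherVertexColors Q l
    sameOthers = subst₂ _↭_ (vertexPart-edgeMonomial P k) (vertexPart-edgeMonomial Q l) (mapMaybe-↭ isInj₁ k↭l)
    sameEndColors : endColors Q l ↭ endColors P k
    sameEndColors = ++-cancelˡ-↭ (otherVertexColors Q l) (begin
      otherVertexColors Q l ++ endColors Q l  ↭⟨ tabulate-vcol↭others++ends Q l ⟨
      tabulate (vcol Q)                       ↭⟨ vertices ⟨
      tabulate (vcol P)                       ↭⟨ tabulate-vcol↭others++ends P k ⟩
      otherVertexColors P k ++ endColors P k  ↭⟨ ++⁺ʳ (endColors P k) sameOthers ⟩
      otherVertexColors Q l ++ endColors P k  ∎)
      where open PermutationReasoning

mainTheorem12 : {V E : Set} (n : ℕ) (P Q : ColoredPath V E n) →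
    DetPolyEq P Q →
    ((tabulate (vcol P) ↭ tabulate (vcol Q)) × (tabulate (ecol P) ↭ tabulate (ecol Q)))
    × (EdgesMatched P Q × EdgesMatched Q P)
mainTheorem12 {V} {E} n P Q same =
    (vertices , edgeColors-↭ P Q edges)
  , edgesMatched P Q vertices edges
  , edgesMatched Q P (↭-sym vertices) (≃-sym edges)
  where
  open FreeCommutativeSemiring (V ⊎ E) using (≃-sym)
  vertices = vertexColors-↭ P Q same
  edges = edgeMonomials-≃ P Q same
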